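{- For every nonnegative integer $n$, $$\sum_{k=0}^n\left((16-x)k^2-4\right)\frac{\binom{2k}k^2}{2k-1}x^{n-k}=\frac{4(n+1)^2}{2n+1}\binom{2n+1}n^2$$ as an identity of polynomials in $x$. -}

module Defs where

open import Data.Nat as ℕ using (ℕ; zero; suc)
open import Data.Nat.Combinatorics using (_C_)
open import Data.Integer as ℤ using (ℤ; +_)
open import Data.Rational as ℚ using (ℚ; 0ℚ; _/_; _÷_)
open import Data.List using (List; []; _∷_; upTo; map; foldr; replicate; _++_)
open import Relation.Binary.PropositionalEquality using (_≡_)

-- Univariate polynomials over ℚ, represented by coefficient lists
-- (lowest degree first). Trailing zeros are allowed; equality of
-- polynomials is coefficientwise equality (_≈ₚ_ below).
Poly : Set
Poly = List ℚ

coeff : Poly → ℕ → ℚ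
coeff []       _       = 0ℚ
coeff (a ∷ p)  zero    = a
coeff (a ∷ p)  (suc j) = coeff p j

_≈ₚ_ : Poly → Poly → Set
p ≈ₚ q = ∀ j → coeff p j ≡ coeff q j

infix 4 _≈ₚ_

_+ₚ_ : Poly → Poly → Poly
[]      +ₚ q       = q
(a ∷ p) +ₚ []      = a ∷ p
(a ∷ p) +ₚ (b ∷ q) = (a ℚ.+ b) ∷ (p +ₚ q)

_·ₚ_ : ℚ → Poly → Poly
c ·ₚ p = map (c ℚ.*_) p

_*ₚ_ : Poly → Poly → Poly
[]      *ₚ q = []
(a ∷ p) *ₚ q = (a ·ₚ q) +ₚ (0ℚ ∷ (p *ₚ q))

const : ℚ → Poly
const c = c ∷ []

X : Poly
X = 0ℚ ∷ ℚ.1ℚ ∷ []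

X^ : ℕ → Poly
X^ m = replicate m 0ℚ ++ (ℚ.1ℚ ∷ [])

∑ₚ[0…_] : ℕ → (ℕ → Poly) → Poly
∑ₚ[0… n ] f = foldr (λ k acc → f k +ₚ acc) [] (upTo (suc n))

ℕ→ℚ : ℕ → ℚ
ℕ→ℚ m = (+ m) / 1

-- 1 / (2k - 1) as a rational: k = 0 gives 1/(-1) = -1,
-- k = m+1 gives 1/(2m+1)
inv2k-1 : ℕ → ℚ
inv2k-1 zero    = ℚ.- ℚ.1ℚ
inv2k-1 (suc m) = (+ 1) / suc (2 ℕ.* m)

summand : ℕ → ℕ → Poly
summand n k =
  (((ℕ→ℚ (2 ℕ.* k C k) ℚ.* ℕ→ℚ (2 ℕ.* k C k)) ℚ.* inv2k-1 k) ·ₚ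
    ((((const (ℕ→ℚ 16) +ₚ ((ℚ.- ℚ.1ℚ) ·ₚ X)) *ₚ const (ℕ→ℚ (k ℕ.* k)))
       +ₚ const (ℚ.- (ℕ→ℚ 4)))
     *ₚ X^ (n ℕ.∸ k)))

rhs : ℕ → ℚ
rhs n = (ℕ→ℚ (4 ℕ.* (suc n ℕ.* suc n)) ℚ.* (ℕ→ℚ (suc (2 ℕ.* n) C n) ℚ.* ℕ→ℚ (suc (2 ℕ.* n) C n)))
        ℚ.* ((+ 1) / suc (2 ℕ.* n))

-- Write L(n) for the left-hand side. Raising n by one multiplies every old
-- summand by x and adds the diagonal summand k = n+1, so
--   L(n+1) = x · L(n) + w(n+1) · ((16(n+1)² - 4) - (n+1)² x),   w(k) = C(2k,k)²/(2k-1).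
-- By induction L(n) is the constant rhs(n), and L(n+1) is the constant rhs(n+1)
-- because of two scalar identities, both consequences of the binomial absorption
-- law (k+1)·C(n+1,k+1) = (n+1)·C(n,k):
--   rhs(n) = (n+1)² · w(n+1)                  (linear coefficient cancels),
--   (16(n+1)² - 4) · w(n+1) = rhs(n+1)        (constant coefficient).
module Submission where

open import Defs
open import Data.Nat as ℕ using (ℕ; zero; suc; _≤_; s≤s)
import Data.Nat.Properties as ℕP
open import Data.Nat.Combinatorics
  using (_C_; nCk+nC[k+1]≡[n+1]C[k+1]; nCk≡nC[n∸k]; nC1≡n; k>n⇒nCk≡0)
open import Data.Nat.Solver using (module +-*-Solver)
open import Data.Integer as ℤ using (+_)
import Data.Integer.Properties as ℤP
open import Data.Rational as ℚ using (ℚ; 0ℚ; 1ℚ; mkℚ; _/_)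
import Data.Rational.Properties as ℚP
import Data.Rational.Solver as ℚSolver
import Data.Nat.Coprimality as Coprimality
open import Data.List using (List; []; _∷_; _++_; foldr; upTo)
open import Data.List.Properties using (upTo-∷ʳ; foldr-++)
open import Level using (0ℓ)
open import Relation.Binary.Bundles using (Setoid)
import Relation.Binary.Reasoning.Setoid as SetoidReasoning
open import Relation.Binary.PropositionalEquality

absorption : ∀ n k → suc k ℕ.* (suc n C suc k) ≡ suc n ℕ.* (n C k)
absorption n zero = begin
  1 ℕ.* (suc n C 1) ≡⟨ ℕP.*-identityˡ _ ⟩
  suc n C 1         ≡⟨ nC1≡n (suc n) ⟩
  suc n             ≡⟨ ℕP.*-identityʳ (suc n) ⟨
  suc n ℕ.* 1       ∎
  where open ≡-Reasoning
absorption zero (suc k) = begin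
  suc (suc k) ℕ.* (1 C suc (suc k)) ≡⟨ cong (suc (suc k) ℕ.*_) (k>n⇒nCk≡0 (s≤s (s≤s (ℕ.z≤n {k})))) ⟩
  suc (suc k) ℕ.* 0                 ≡⟨ ℕP.*-zeroʳ (suc (suc k)) ⟩
  0                                 ∎
  where open ≡-Reasoning
absorption (suc n) (suc k) = begin
  (2 ℕ.+ k) ℕ.* (suc (suc n) C suc (suc k))
    ≡⟨ cong ((2 ℕ.+ k) ℕ.*_) (nCk+nC[k+1]≡[n+1]C[k+1] (suc n) (suc k)) ⟨
  (2 ℕ.+ k) ℕ.* (x ℕ.+ y)
    ≡⟨ regroup k x y ⟩
  (suc k ℕ.* x ℕ.+ suc (suc k) ℕ.* y) ℕ.+ x
    ≡⟨ cong₂ (λ a b → a ℕ.+ b ℕ.+ x) (absorption n k) (absorption n (suc k)) ⟩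
  (suc n ℕ.* (n C k) ℕ.+ suc n ℕ.* (n C suc k)) ℕ.+ x
    ≡⟨ cong (ℕ._+ x) (ℕP.*-distribˡ-+ (suc n) (n C k) (n C suc k)) ⟨
  suc n ℕ.* (n C k ℕ.+ n C suc k) ℕ.+ x
    ≡⟨ cong (λ z → suc n ℕ.* z ℕ.+ x) (nCk+nC[k+1]≡[n+1]C[k+1] n k) ⟩
  suc n ℕ.* x ℕ.+ x
    ≡⟨ ℕP.+-comm (suc n ℕ.* x) x ⟩
  (2 ℕ.+ n) ℕ.* x ∎
  where
  open ≡-Reasoning
  x = suc n C suc k
  y = suc n C suc (suc k)
  regroup : ∀ k x y → (2 ℕ.+ k) ℕ.* (x ℕ.+ y) ≡ (suc k ℕ.* x ℕ.+ suc (suc k) ℕ.* y) ℕ.+ x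
  regroup = solve 3 (λ k x y → (con 2 :+ k) :* (x :+ y) := ((con 1 :+ k) :* x :+ (con 2 :+ k) :* y) :+ x) refl
    where open +-*-Solver

central : ℕ → ℕ
central m = (2 ℕ.* m) C m

odd-central : ℕ → ℕ
odd-central m = suc (2 ℕ.* m) C m

-- (m+1)·C(2m+1,m) = (2m+1)·C(2m,m): absorption plus the symmetry
-- C(2m+1,m+1) = C(2m+1,m).
odd-central-absorption : ∀ m → suc m ℕ.* odd-central m ≡ suc (2 ℕ.* m) ℕ.* central m
odd-central-absorption m = begin
  suc m ℕ.* odd-central m                  ≡⟨ cong (suc m ℕ.*_) symmetry ⟨
  suc m ℕ.* (suc (2 ℕ.* m) C suc m)        ≡⟨ absorption (2 ℕ.* m) m ⟩
  suc (2 ℕ.* m) ℕ.* central m              ∎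
  where
  open ≡-Reasoning
  symmetry : suc (2 ℕ.* m) C suc m ≡ odd-central m
  symmetry = trans (nCk≡nC[n∸k] (s≤s (ℕP.m≤m+n m (m ℕ.+ 0))))
                   (cong (suc (2 ℕ.* m) C_) (trans (ℕP.m+n∸m≡n m (m ℕ.+ 0)) (ℕP.+-identityʳ m)))

-- C(2m+2,m+1) = 2·C(2m+1,m): absorption, after cancelling the factor m+1.
central-suc : ∀ m → central (suc m) ≡ 2 ℕ.* odd-central m
central-suc m = ℕP.*-cancelˡ-≡ _ _ (suc m) (begin
  suc m ℕ.* ((2 ℕ.* suc m) C suc m)              ≡⟨ cong (λ z → suc m ℕ.* (z C suc m)) two-m+2 ⟩
  suc m ℕ.* (suc (suc (2 ℕ.* m)) C suc m)        ≡⟨ absorption (suc (2 ℕ.* m)) m ⟩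
  suc (suc (2 ℕ.* m)) ℕ.* odd-central m          ≡⟨ cong (ℕ._* odd-central m) two-m+2 ⟨
  (2 ℕ.* suc m) ℕ.* odd-central m                ≡⟨ reassoc m (odd-central m) ⟩
  suc m ℕ.* (2 ℕ.* odd-central m)                ∎)
  where
  open ≡-Reasoning
  two-m+2 : 2 ℕ.* suc m ≡ suc (suc (2 ℕ.* m))
  two-m+2 = cong suc (ℕP.+-suc m (m ℕ.+ 0))
  reassoc : ∀ m e → (2 ℕ.* suc m) ℕ.* e ≡ suc m ℕ.* (2 ℕ.* e)
  reassoc = solve 2 (λ m e → (con 2 :* (con 1 :+ m)) :* e := (con 1 :+ m) :* (con 2 :* e)) refl
    where open +-*-Solver

-- ℕ→ℚ is a semiring homomorphism; together with the cancellation law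
-- ℕ→ℚ (a·(k+1)) · 1/(k+1) = ℕ→ℚ a this lets every rational identity
-- below be reduced to an identity between natural numbers.
-- ℕ→ℚ a is the normalised fraction a/1.
ℕ→ℚ-normal : ∀ a → ℕ→ℚ a ≡ mkℚ (+ a) 0 (Coprimality.sym (Coprimality.1-coprimeTo a))
ℕ→ℚ-normal a = ℚP.↥p/↧p≡p (mkℚ (+ a) 0 (Coprimality.sym (Coprimality.1-coprimeTo a)))

ℕ→ℚ-+ : ∀ a b → ℕ→ℚ a ℚ.+ ℕ→ℚ b ≡ ℕ→ℚ (a ℕ.+ b)
ℕ→ℚ-+ a b = trans (cong₂ ℚ._+_ (ℕ→ℚ-normal a) (ℕ→ℚ-normal b))
  (cong (_/ 1) (trans (cong₂ ℤ._+_ (ℤP.*-identityʳ (+ a)) (ℤP.*-identityʳ (+ b)))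
                      (sym (ℤP.pos-+ a b))))

ℕ→ℚ-* : ∀ a b → ℕ→ℚ a ℚ.* ℕ→ℚ b ≡ ℕ→ℚ (a ℕ.* b)
ℕ→ℚ-* a b = trans (cong₂ ℚ._*_ (ℕ→ℚ-normal a) (ℕ→ℚ-normal b)) (cong (_/ 1) (sym (ℤP.pos-* a b)))

ℕ→ℚ-inverse : ∀ k → ℕ→ℚ (suc k) ℚ.* ((+ 1) / suc k) ≡ 1ℚ
ℕ→ℚ-inverse k =
  trans (cong₂ ℚ._*_ (ℕ→ℚ-normal (suc k)) (ℚP.↥p/↧p≡p (mkℚ (+ 1) k (Coprimality.1-coprimeTo _))))
        (ℚP.*-inverseʳ (mkℚ (+ suc k) 0 (Coprimality.sym (Coprimality.1-coprimeTo (suc k)))))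

ℕ→ℚ-cancel : ∀ a k → ℕ→ℚ (a ℕ.* suc k) ℚ.* ((+ 1) / suc k) ≡ ℕ→ℚ a
ℕ→ℚ-cancel a k = begin
  ℕ→ℚ (a ℕ.* suc k) ℚ.* i               ≡⟨ cong (ℚ._* i) (ℕ→ℚ-* a (suc k)) ⟨
  ℕ→ℚ a ℚ.* ℕ→ℚ (suc k) ℚ.* i           ≡⟨ ℚP.*-assoc (ℕ→ℚ a) (ℕ→ℚ (suc k)) i ⟩
  ℕ→ℚ a ℚ.* (ℕ→ℚ (suc k) ℚ.* i)         ≡⟨ cong (ℕ→ℚ a ℚ.*_) (ℕ→ℚ-inverse k) ⟩
  ℕ→ℚ a ℚ.* 1ℚ                          ≡⟨ ℚP.*-identityʳ (ℕ→ℚ a) ⟩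
  ℕ→ℚ a                                 ∎
  where
  open ≡-Reasoning
  i = (+ 1) / suc k

ℕ→ℚ-*-square : ∀ a e → ℕ→ℚ a ℚ.* (ℕ→ℚ e ℚ.* ℕ→ℚ e) ≡ ℕ→ℚ (a ℕ.* (e ℕ.* e))
ℕ→ℚ-*-square a e = trans (cong (ℕ→ℚ a ℚ.*_) (ℕ→ℚ-* e e)) (ℕ→ℚ-* a (e ℕ.* e))

-- Polynomial equality packaged as a record: unlike the bare function type
-- p ≈ₚ q, the record type determines its endpoints p and q, so they can be
-- inferred when equalities are combined.
record _≋_ (p q : Poly) : Set where
  constructor coeffwise
  field at : p ≈ₚ q
open _≋_

infix 4 _≋_

≋-refl : ∀ {p} → p ≋ p
≋-refl = coeffwise λ _ → refl

≋-setoid : Setoid 0ℓ 0ℓ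
≋-setoid = record
  { Carrier       = Poly
  ; _≈_           = _≋_
  ; isEquivalence = record
    { refl  = ≋-refl
    ; sym   = λ p≋r → coeffwise λ j → sym (at p≋r j)
    ; trans = λ p≋r r≋s → coeffwise λ j → trans (at p≋r j) (at r≋s j)
    }
  }

module ≋-Reasoning = SetoidReasoning ≋-setoid

≡⇒≋ : ∀ {p q} → p ≡ q → p ≋ q
≡⇒≋ refl = ≋-refl

∷-cong : ∀ a {p r} → p ≋ r → a ∷ p ≋ a ∷ r
∷-cong a p≋r = coeffwise λ { zero → refl ; (suc j) → at p≋r j }

coeff-+ₚ : ∀ p r j → coeff (p +ₚ r) j ≡ coeff p j ℚ.+ coeff r j
coeff-+ₚ []      r       j       = sym (ℚP.+-identityˡ _)
coeff-+ₚ (a ∷ p) []      j       = sym (ℚP.+-identityʳ _)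
coeff-+ₚ (a ∷ p) (b ∷ r) zero    = refl
coeff-+ₚ (a ∷ p) (b ∷ r) (suc j) = coeff-+ₚ p r j

coeff-·ₚ : ∀ c p j → coeff (c ·ₚ p) j ≡ c ℚ.* coeff p j
coeff-·ₚ c []      j       = sym (ℚP.*-zeroʳ c)
coeff-·ₚ c (a ∷ p) zero    = refl
coeff-·ₚ c (a ∷ p) (suc j) = coeff-·ₚ c p j

+ₚ-cong : ∀ {p p′ r r′} → p ≋ p′ → r ≋ r′ → p +ₚ r ≋ p′ +ₚ r′
+ₚ-cong {p} {p′} {r} {r′} p≋p′ r≋r′ = coeffwise λ j → begin
  coeff (p +ₚ r) j           ≡⟨ coeff-+ₚ p r j ⟩
  coeff p j ℚ.+ coeff r j    ≡⟨ cong₂ ℚ._+_ (at p≋p′ j) (at r≋r′ j) ⟩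
  coeff p′ j ℚ.+ coeff r′ j  ≡⟨ coeff-+ₚ p′ r′ j ⟨
  coeff (p′ +ₚ r′) j         ∎
  where open ≡-Reasoning

·ₚ-cong : ∀ c {p r} → p ≋ r → c ·ₚ p ≋ c ·ₚ r
·ₚ-cong c {p} {r} p≋r = coeffwise λ j → begin
  coeff (c ·ₚ p) j     ≡⟨ coeff-·ₚ c p j ⟩
  c ℚ.* coeff p j      ≡⟨ cong (c ℚ.*_) (at p≋r j) ⟩
  c ℚ.* coeff r j      ≡⟨ coeff-·ₚ c r j ⟨
  coeff (c ·ₚ r) j     ∎
  where open ≡-Reasoning

+ₚ-identityʳ : ∀ p → p +ₚ [] ≡ p
+ₚ-identityʳ []      = refl
+ₚ-identityʳ (a ∷ p) = refl

+ₚ-assoc : ∀ p r s → (p +ₚ r) +ₚ s ≋ p +ₚ (r +ₚ s)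
+ₚ-assoc p r s = coeffwise λ j → begin
  coeff ((p +ₚ r) +ₚ s) j                     ≡⟨ coeff-+ₚ (p +ₚ r) s j ⟩
  coeff (p +ₚ r) j ℚ.+ coeff s j              ≡⟨ cong (ℚ._+ coeff s j) (coeff-+ₚ p r j) ⟩
  coeff p j ℚ.+ coeff r j ℚ.+ coeff s j       ≡⟨ ℚP.+-assoc (coeff p j) (coeff r j) (coeff s j) ⟩
  coeff p j ℚ.+ (coeff r j ℚ.+ coeff s j)     ≡⟨ cong (coeff p j ℚ.+_) (coeff-+ₚ r s j) ⟨
  coeff p j ℚ.+ coeff (r +ₚ s) j              ≡⟨ coeff-+ₚ p (r +ₚ s) j ⟨
  coeff (p +ₚ (r +ₚ s)) j                     ∎
  where open ≡-Reasoning

-- Multiplication by x is consing a zero coefficient; it commutes with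
-- scalar multiplication and with multiplication by another polynomial.
·ₚ-shift : ∀ c p → c ·ₚ (0ℚ ∷ p) ≋ 0ℚ ∷ (c ·ₚ p)
·ₚ-shift c p = coeffwise λ { zero → ℚP.*-zeroʳ c ; (suc j) → refl }

*ₚ-shift : ∀ p r → p *ₚ (0ℚ ∷ r) ≋ 0ℚ ∷ (p *ₚ r)
*ₚ-shift []      r = coeffwise λ { zero → refl ; (suc j) → refl }
*ₚ-shift (a ∷ p) r = +ₚ-cong (·ₚ-shift a r) (∷-cong 0ℚ (*ₚ-shift p r))

∑ₗ : (ℕ → Poly) → List ℕ → Poly
∑ₗ f = foldr (λ k acc → f k +ₚ acc) []

∑ₗ-onto : ∀ f b l → foldr (λ k acc → f k +ₚ acc) b l ≋ ∑ₗ f l +ₚ b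
∑ₗ-onto f b []      = ≋-refl
∑ₗ-onto f b (k ∷ l) = begin
  f k +ₚ foldr (λ k acc → f k +ₚ acc) b l   ≈⟨ +ₚ-cong ≋-refl (∑ₗ-onto f b l) ⟩
  f k +ₚ (∑ₗ f l +ₚ b)                       ≈⟨ +ₚ-assoc (f k) (∑ₗ f l) b ⟨
  (f k +ₚ ∑ₗ f l) +ₚ b                       ∎
  where open ≋-Reasoning

∑ₚ-step : ∀ f n → ∑ₚ[0… suc n ] f ≋ ∑ₚ[0… n ] f +ₚ f (suc n)
∑ₚ-step f n = begin
  ∑ₗ f (upTo (suc (suc n)))
    ≡⟨ cong (∑ₗ f) (upTo-∷ʳ (suc n)) ⟨
  ∑ₗ f (upTo (suc n) ++ suc n ∷ [])
    ≡⟨ foldr-++ (λ k acc → f k +ₚ acc) [] (upTo (suc n)) (suc n ∷ []) ⟩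
  foldr (λ k acc → f k +ₚ acc) (f (suc n) +ₚ []) (upTo (suc n))
    ≈⟨ ∑ₗ-onto f (f (suc n) +ₚ []) (upTo (suc n)) ⟩
  ∑ₗ f (upTo (suc n)) +ₚ (f (suc n) +ₚ [])
    ≡⟨ cong (∑ₗ f (upTo (suc n)) +ₚ_) (+ₚ-identityʳ (f (suc n))) ⟩
  ∑ₗ f (upTo (suc n)) +ₚ f (suc n) ∎
  where open ≋-Reasoning

∑ₚ-cong : ∀ {f g} n → (∀ k → k ≤ n → f k ≋ g k) → ∑ₚ[0… n ] f ≋ ∑ₚ[0… n ] g
∑ₚ-cong {f} {g} zero    f≋g = +ₚ-cong (f≋g 0 ℕ.z≤n) ≋-refl
∑ₚ-cong {f} {g} (suc n) f≋g = begin
  ∑ₚ[0… suc n ] f            ≈⟨ ∑ₚ-step f n ⟩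
  ∑ₚ[0… n ] f +ₚ f (suc n)   ≈⟨ +ₚ-cong (∑ₚ-cong n (λ k k≤n → f≋g k (ℕP.m≤n⇒m≤1+n k≤n)))
                                         (f≋g (suc n) ℕP.≤-refl) ⟩
  ∑ₚ[0… n ] g +ₚ g (suc n)   ≈⟨ ∑ₚ-step g n ⟨
  ∑ₚ[0… suc n ] g            ∎
  where open ≋-Reasoning

∑ₚ-shift : ∀ f n → ∑ₚ[0… n ] (λ k → 0ℚ ∷ f k) ≋ 0ℚ ∷ ∑ₚ[0… n ] f
∑ₚ-shift f zero    = ∷-cong 0ℚ (≡⇒≋ (sym (+ₚ-identityʳ (f 0))))
∑ₚ-shift f (suc n) = begin
  ∑ₚ[0… suc n ] (λ k → 0ℚ ∷ f k)                ≈⟨ ∑ₚ-step (λ k → 0ℚ ∷ f k) n ⟩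
  ∑ₚ[0… n ] (λ k → 0ℚ ∷ f k) +ₚ (0ℚ ∷ f (suc n)) ≈⟨ +ₚ-cong (∑ₚ-shift f n) ≋-refl ⟩
  0ℚ ∷ (∑ₚ[0… n ] f +ₚ f (suc n))               ≈⟨ ∷-cong 0ℚ (∑ₚ-step f n) ⟨
  0ℚ ∷ ∑ₚ[0… suc n ] f                          ∎
  where open ≋-Reasoning

weight : ℕ → ℚ
weight k = (ℕ→ℚ (central k) ℚ.* ℕ→ℚ (central k)) ℚ.* inv2k-1 k

-- The polynomial factor (16 - x)k² - 4 of the k-th summand, so that
-- summand n k = weight k · factor k · x^(n-k).
factor : ℕ → Poly
factor k = ((const (ℕ→ℚ 16) +ₚ ((ℚ.- ℚ.1ℚ) ·ₚ X)) *ₚ const (ℕ→ℚ (k ℕ.* k))) +ₚ const (ℚ.- (ℕ→ℚ 4))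

lhs : ℕ → Poly
lhs n = ∑ₚ[0… n ] (summand n)

summand-shift : ∀ n k → k ≤ n → summand (suc n) k ≋ 0ℚ ∷ summand n k
summand-shift n k k≤n = begin
  summand (suc n) k                                ≡⟨ cong (λ d → weight k ·ₚ (factor k *ₚ X^ d)) (ℕP.+-∸-assoc 1 k≤n) ⟩
  weight k ·ₚ (factor k *ₚ (0ℚ ∷ X^ (n ℕ.∸ k)))    ≈⟨ ·ₚ-cong (weight k) (*ₚ-shift (factor k) (X^ (n ℕ.∸ k))) ⟩
  weight k ·ₚ (0ℚ ∷ (factor k *ₚ X^ (n ℕ.∸ k)))    ≈⟨ ·ₚ-shift (weight k) (factor k *ₚ X^ (n ℕ.∸ k)) ⟩
  0ℚ ∷ summand n k                                 ∎
  where open ≋-Reasoning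

lhs-recurrence : ∀ n → lhs (suc n) ≋ (0ℚ ∷ lhs n) +ₚ summand (suc n) (suc n)
lhs-recurrence n = begin
  lhs (suc n)                                                         ≈⟨ ∑ₚ-step (summand (suc n)) n ⟩
  ∑ₚ[0… n ] (summand (suc n)) +ₚ summand (suc n) (suc n)              ≈⟨ +ₚ-cong shifted ≋-refl ⟩
  (0ℚ ∷ lhs n) +ₚ summand (suc n) (suc n)                             ∎
  where
  open ≋-Reasoning
  shifted : ∑ₚ[0… n ] (summand (suc n)) ≋ 0ℚ ∷ lhs n
  shifted = begin
    ∑ₚ[0… n ] (summand (suc n))            ≈⟨ ∑ₚ-cong n (summand-shift n) ⟩
    ∑ₚ[0… n ] (λ k → 0ℚ ∷ summand n k)     ≈⟨ ∑ₚ-shift (summand n) n ⟩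
    0ℚ ∷ lhs n                             ∎

summand-diagonal : ∀ m → summand m m ≡ weight m ·ₚ (factor m *ₚ (1ℚ ∷ []))
summand-diagonal m = cong (λ d → weight m ·ₚ (factor m *ₚ X^ d)) (ℕP.n∸n≡0 m)

diagonal-coeff₀ : ∀ m → coeff (summand m m) 0 ≡ weight m ℚ.* (ℕ→ℚ 16 ℚ.* ℕ→ℚ (m ℕ.* m) ℚ.- ℕ→ℚ 4)
diagonal-coeff₀ m = trans (cong (λ p → coeff p 0) (summand-diagonal m))
  (normalise (weight m) (ℕ→ℚ 16) (ℕ→ℚ (m ℕ.* m)) (ℕ→ℚ 4))
  where
  normalise : ∀ w a b c → w ℚ.* ((((a ℚ.+ (ℚ.- 1ℚ) ℚ.* 0ℚ) ℚ.* b ℚ.+ 0ℚ) ℚ.+ ℚ.- c) ℚ.* 1ℚ ℚ.+ 0ℚ)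
                        ≡ w ℚ.* (a ℚ.* b ℚ.- c)
  normalise = solve 4 (λ w a b c → w :* ((((a :+ (:- con 1ℚ) :* con 0ℚ) :* b :+ con 0ℚ) :+ :- c) :* con 1ℚ :+ con 0ℚ)
                                 := w :* (a :* b :- c)) refl
    where open ℚSolver.+-*-Solver

diagonal-coeff₁ : ∀ m → coeff (summand m m) 1 ≡ ℚ.- (weight m ℚ.* ℕ→ℚ (m ℕ.* m))
diagonal-coeff₁ m = trans (cong (λ p → coeff p 1) (summand-diagonal m))
  (normalise (weight m) (ℕ→ℚ (m ℕ.* m)))
  where
  normalise : ∀ w b → w ℚ.* ((((ℚ.- 1ℚ) ℚ.* 1ℚ) ℚ.* b ℚ.+ 0ℚ) ℚ.* 1ℚ ℚ.+ 0ℚ) ≡ ℚ.- (w ℚ.* b)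
  normalise = solve 2 (λ w b → w :* ((((:- con 1ℚ) :* con 1ℚ) :* b :+ con 0ℚ) :* con 1ℚ :+ con 0ℚ) := :- (w :* b)) refl
    where open ℚSolver.+-*-Solver

diagonal-coeff-high : ∀ m j → coeff (summand m m) (2 ℕ.+ j) ≡ 0ℚ
diagonal-coeff-high m j = cong (λ p → coeff p (2 ℕ.+ j)) (summand-diagonal m)

rhs-closed : ∀ m → rhs m ≡ ℕ→ℚ (4 ℕ.* suc (2 ℕ.* m) ℕ.* (central m ℕ.* central m))
rhs-closed m = begin
  ℕ→ℚ (4 ℕ.* (m+1 ℕ.* m+1)) ℚ.* (ℕ→ℚ e ℚ.* ℕ→ℚ e) ℚ.* i
    ≡⟨ cong (ℚ._* i) (ℕ→ℚ-*-square (4 ℕ.* (m+1 ℕ.* m+1)) e) ⟩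
  ℕ→ℚ (4 ℕ.* (m+1 ℕ.* m+1) ℕ.* (e ℕ.* e)) ℚ.* i
    ≡⟨ cong (λ z → ℕ→ℚ z ℚ.* i) (square-absorption m+1 e t c (odd-central-absorption m)) ⟩
  ℕ→ℚ (4 ℕ.* t ℕ.* (c ℕ.* c) ℕ.* t) ℚ.* i
    ≡⟨ ℕ→ℚ-cancel (4 ℕ.* t ℕ.* (c ℕ.* c)) (2 ℕ.* m) ⟩
  ℕ→ℚ (4 ℕ.* t ℕ.* (c ℕ.* c)) ∎
  where
  open ≡-Reasoning
  t = suc (2 ℕ.* m)
  m+1 = suc m
  e = odd-central m
  c = central m
  i = (+ 1) / t
  square-absorption : ∀ a e b d → a ℕ.* e ≡ b ℕ.* d →
                      4 ℕ.* (a ℕ.* a) ℕ.* (e ℕ.* e) ≡ 4 ℕ.* b ℕ.* (d ℕ.* d) ℕ.* b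
  square-absorption a e b d ae≡bd = begin
    4 ℕ.* (a ℕ.* a) ℕ.* (e ℕ.* e)     ≡⟨ solve 2 (λ a e → con 4 :* (a :* a) :* (e :* e) := con 4 :* ((a :* e) :* (a :* e))) refl a e ⟩
    4 ℕ.* ((a ℕ.* e) ℕ.* (a ℕ.* e))   ≡⟨ cong (λ z → 4 ℕ.* (z ℕ.* z)) ae≡bd ⟩
    4 ℕ.* ((b ℕ.* d) ℕ.* (b ℕ.* d))   ≡⟨ solve 2 (λ b d → con 4 :* ((b :* d) :* (b :* d)) := con 4 :* b :* (d :* d) :* b) refl b d ⟩
    4 ℕ.* b ℕ.* (d ℕ.* d) ℕ.* b       ∎
    where open +-*-Solver

-- Coefficient of x in the recurrence: rhs n = (n+1)²·weight(n+1),
-- because C(2n+2,n+1) = 2·C(2n+1,n).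
rhs-linear : ∀ n → rhs n ≡ weight (suc n) ℚ.* ℕ→ℚ (suc n ℕ.* suc n)
rhs-linear n = begin
  ℕ→ℚ (4 ℕ.* mm) ℚ.* (ℕ→ℚ e ℚ.* ℕ→ℚ e) ℚ.* i      ≡⟨ cong (ℚ._* i) (ℕ→ℚ-*-square (4 ℕ.* mm) e) ⟩
  ℕ→ℚ (4 ℕ.* mm ℕ.* (e ℕ.* e)) ℚ.* i             ≡⟨ cong (λ z → ℕ→ℚ z ℚ.* i) double-square ⟩
  ℕ→ℚ (mm ℕ.* (c ℕ.* c)) ℚ.* i                   ≡⟨ cong (ℚ._* i) (ℕ→ℚ-*-square mm c) ⟨
  ℕ→ℚ mm ℚ.* (ℕ→ℚ c ℚ.* ℕ→ℚ c) ℚ.* i             ≡⟨ reorder (ℕ→ℚ mm) (ℕ→ℚ c) i ⟩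
  weight (suc n) ℚ.* ℕ→ℚ mm                      ∎
  where
  open ≡-Reasoning
  mm = suc n ℕ.* suc n
  e = odd-central n
  c = central (suc n)
  i = (+ 1) / suc (2 ℕ.* n)
  double-square : 4 ℕ.* mm ℕ.* (e ℕ.* e) ≡ mm ℕ.* (c ℕ.* c)
  double-square = begin
    4 ℕ.* mm ℕ.* (e ℕ.* e)                  ≡⟨ solve 2 (λ mm e → con 4 :* mm :* (e :* e) := mm :* ((con 2 :* e) :* (con 2 :* e))) refl mm e ⟩
    mm ℕ.* ((2 ℕ.* e) ℕ.* (2 ℕ.* e))        ≡⟨ cong (λ z → mm ℕ.* (z ℕ.* z)) (central-suc n) ⟨
    mm ℕ.* (c ℕ.* c)                        ∎
    where open +-*-Solver
  reorder : ∀ y x i → y ℚ.* (x ℚ.* x) ℚ.* i ≡ x ℚ.* x ℚ.* i ℚ.* y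
  reorder = solve 3 (λ y x i → y :* (x :* x) :* i := x :* x :* i :* y) refl
    where open ℚSolver.+-*-Solver

-- Constant coefficient of the recurrence: (16(n+1)² - 4)·weight(n+1) = rhs(n+1),
-- because 16(n+1)² - 4 = 4(2n+3)(2n+1) and rhs has the closed form above.
rhs-constant : ∀ n → weight (suc n) ℚ.* (ℕ→ℚ 16 ℚ.* ℕ→ℚ (suc n ℕ.* suc n) ℚ.- ℕ→ℚ 4) ≡ rhs (suc n)
rhs-constant n = begin
  w ℚ.* (ℕ→ℚ 16 ℚ.* ℕ→ℚ mm ℚ.- ℕ→ℚ 4)
    ≡⟨ cong (λ z → w ℚ.* (z ℚ.- ℕ→ℚ 4)) sixteen-mm ⟩
  w ℚ.* (ℕ→ℚ (4 ℕ.* t ℕ.* s) ℚ.+ ℕ→ℚ 4 ℚ.- ℕ→ℚ 4)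
    ≡⟨ cancel-four (ℕ→ℚ c) i (ℕ→ℚ (4 ℕ.* t ℕ.* s)) (ℕ→ℚ 4) ⟩
  ℕ→ℚ (4 ℕ.* t ℕ.* s) ℚ.* (ℕ→ℚ c ℚ.* ℕ→ℚ c) ℚ.* i
    ≡⟨ cong (ℚ._* i) (ℕ→ℚ-*-square (4 ℕ.* t ℕ.* s) c) ⟩
  ℕ→ℚ (4 ℕ.* t ℕ.* s ℕ.* (c ℕ.* c)) ℚ.* i
    ≡⟨ cong (λ z → ℕ→ℚ z ℚ.* i) (swap (4 ℕ.* t) s (c ℕ.* c)) ⟩
  ℕ→ℚ (4 ℕ.* t ℕ.* (c ℕ.* c) ℕ.* s) ℚ.* i
    ≡⟨ ℕ→ℚ-cancel (4 ℕ.* t ℕ.* (c ℕ.* c)) (2 ℕ.* n) ⟩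
  ℕ→ℚ (4 ℕ.* t ℕ.* (c ℕ.* c))
    ≡⟨ rhs-closed (suc n) ⟨
  rhs (suc n) ∎
  where
  open ≡-Reasoning
  mm = suc n ℕ.* suc n
  s = suc (2 ℕ.* n)
  t = suc (2 ℕ.* suc n)
  c = central (suc n)
  i = (+ 1) / s
  w = weight (suc n)
  sixteen-mm : ℕ→ℚ 16 ℚ.* ℕ→ℚ mm ≡ ℕ→ℚ (4 ℕ.* t ℕ.* s) ℚ.+ ℕ→ℚ 4
  sixteen-mm = begin
    ℕ→ℚ 16 ℚ.* ℕ→ℚ mm               ≡⟨ ℕ→ℚ-* 16 mm ⟩
    ℕ→ℚ (16 ℕ.* mm)                 ≡⟨ cong ℕ→ℚ (solve 1 (λ n → con 16 :* ((con 1 :+ n) :* (con 1 :+ n))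
                                          := con 4 :* (con 1 :+ con 2 :* (con 1 :+ n)) :* (con 1 :+ con 2 :* n) :+ con 4) refl n) ⟩
    ℕ→ℚ (4 ℕ.* t ℕ.* s ℕ.+ 4)       ≡⟨ ℕ→ℚ-+ (4 ℕ.* t ℕ.* s) 4 ⟨
    ℕ→ℚ (4 ℕ.* t ℕ.* s) ℚ.+ ℕ→ℚ 4   ∎
    where open +-*-Solver
  cancel-four : ∀ x i y f → x ℚ.* x ℚ.* i ℚ.* (y ℚ.+ f ℚ.- f) ≡ y ℚ.* (x ℚ.* x) ℚ.* i
  cancel-four = solve 4 (λ x i y f → x :* x :* i :* (y :+ f :- f) := y :* (x :* x) :* i) refl
    where open ℚSolver.+-*-Solver
  swap : ∀ a b d → a ℕ.* b ℕ.* d ≡ a ℕ.* d ℕ.* b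
  swap a b d = solve 3 (λ a b d → a :* b :* d := a :* d :* b) refl a b d
    where open +-*-Solver

x·constant+t : ∀ p t {r r′} → p ≋ const r →
               coeff t 0 ≡ r′ → r ℚ.+ coeff t 1 ≡ 0ℚ → (∀ j → coeff t (2 ℕ.+ j) ≡ 0ℚ) →
               (0ℚ ∷ p) +ₚ t ≋ const r′
x·constant+t p t {r} {r′} p≋r t₀ t₁ t₂₊ = coeffwise λ j → trans (coeff-+ₚ (0ℚ ∷ p) t j) (by-degree j)
  where
  by-degree : ∀ j → coeff (0ℚ ∷ p) j ℚ.+ coeff t j ≡ coeff (const r′) j
  by-degree zero          = trans (ℚP.+-identityˡ (coeff t 0)) t₀
  by-degree (suc zero)    = trans (cong (ℚ._+ coeff t 1) (at p≋r 0)) t₁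
  by-degree (suc (suc j)) = cong₂ ℚ._+_ (at p≋r (suc j)) (t₂₊ j)

lemma2p2 : (n : ℕ) → ∑ₚ[0… n ] (summand n) ≈ₚ const (rhs n)
lemma2p2 zero zero                = refl
lemma2p2 zero (suc zero)          = refl
lemma2p2 zero (suc (suc j))       = refl
lemma2p2 (suc n) = at (begin
  lhs (suc n)                               ≈⟨ lhs-recurrence n ⟩
  (0ℚ ∷ lhs n) +ₚ summand (suc n) (suc n)   ≈⟨ x·constant+t (lhs n) (summand (suc n) (suc n)) (coeffwise (lemma2p2 n))
                                                 constant-term linear-term (diagonal-coeff-high (suc n)) ⟩
  const (rhs (suc n))                       ∎)
  where
  open ≋-Reasoning
  constant-term : coeff (summand (suc n) (suc n)) 0 ≡ rhs (suc n)
  constant-term = trans (diagonal-coeff₀ (suc n)) (rhs-constant n)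
  linear-term : rhs n ℚ.+ coeff (summand (suc n) (suc n)) 1 ≡ 0ℚ
  linear-term = trans (cong₂ ℚ._+_ (rhs-linear n) (diagonal-coeff₁ (suc n))) (ℚP.+-inverseʳ (weight (suc n) ℚ.* ℕ→ℚ (suc n ℕ.* suc n)))
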